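{- For every $n\in\{2,4,6,\ldots\}$, $$\sum_{\substack{0\le k\le n\\ 4\mid k-2}}\binom nk(-1)^{\frac{k-2}4}2^{\frac{3k}2}B_{n-k}=\frac n2\Big((-1)^{\lfloor\frac{n-2}4\rfloor}2^{\frac{3n}2-2}-(-1)^{\frac n2}2^{n-1}+4U_{n-1}(2,5)\Big).$$
   Context: The Bernoulli numbers $B_n$ are defined by $B_0=1$ and $\sum_{k=0}^{n-1}\binom nkB_k=0$ for $n\ge 2$. For numbers $b,c$, the Lucas sequence $U_n(b,c)$ is defined by $U_0(b,c)=0$, $U_1(b,c)=1$, $U_{n+1}(b,c)=bU_n(b,c)-cU_{n-1}(b,c)$ for $n\ge1$. $\lfloor y\rfloor$ denotes the greatest integer not exceeding $y$. -}

module Defs where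

open import Data.Nat as ℕ using (ℕ; zero; suc; _∸_)
open import Data.Nat.DivMod using (_/_; _%_)
open import Data.Nat.Combinatorics using (_C_)
open import Data.Integer as ℤ using (ℤ; +_)
open import Data.Rational as ℚ using (ℚ)
open import Data.List using (List; []; _∷_; foldr; upTo; length; lookup; _++_; [_])
open import Data.Fin using (Fin; toℕ)
open import Data.Bool using (if_then_else_)

ℤ→ℚ : ℤ → ℚ
ℤ→ℚ z = z ℚ./ 1

Σℚ : ℕ → (ℕ → ℚ) → ℚ
Σℚ m f = foldr (λ k acc → f k ℚ.+ acc) ℚ.0ℚ (upTo m)

-- Bernoulli numbers: B_0 = 1 and, for m ≥ 1,
-- Σ_{k=0}^{m} (m+1 choose k) B_k = 0, i.e. the defining relation
-- Σ_{k=0}^{n-1} (n choose k) B_k = 0 with n = m+1 ≥ 2, solved for B_m: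
--   B_m = -(1/(m+1)) Σ_{k<m} (m+1 choose k) B_k.
-- bernoulliList m = [B_0, ..., B_{m-1}]
bernoulliNext : List ℚ → ℚ
bernoulliNext bs =
  ℚ.- (((+ 1) ℚ./ suc m) ℚ.*
        foldr (λ p acc → p ℚ.+ acc) ℚ.0ℚ (go 0 bs))
  where
  m = length bs
  go : ℕ → List ℚ → List ℚ
  go k []       = []
  go k (b ∷ rest) = (ℤ→ℚ (+ (suc m C k)) ℚ.* b) ∷ go (suc k) rest

bernoulliList : ℕ → List ℚ
bernoulliList zero    = []
bernoulliList (suc m) with bernoulliList m
... | [] = ℚ.1ℚ ∷ []
... | bs@(_ ∷ _) = bs ++ [ bernoulliNext bs ]

B : ℕ → ℚ
B m = lastOr (bernoulliList (suc m))
  where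
  lastOr : List ℚ → ℚ
  lastOr [] = ℚ.0ℚ
  lastOr (x ∷ []) = x
  lastOr (_ ∷ y ∷ ys) = lastOr (y ∷ ys)

U : ℕ → ℤ → ℤ → ℤ
U zero b c = + 0
U (suc zero) b c = + 1
U (suc (suc n)) b c = b ℤ.* U (suc n) b c ℤ.- c ℤ.* U n b c

sgn : ℕ → ℤ
sgn j = ℤ.-1ℤ ℤ.^ j

-- LHS of Corollary 2.6:
-- Σ_{0≤k≤n, 4 ∣ k-2} (n choose k) (-1)^{(k-2)/4} 2^{3k/2} B_{n-k}
-- (the condition 4 ∣ k-2 for natural k is k % 4 ≡ 2; for such k the
--  natural-number divisions (k-2)/4 and 3k/2 are exact)
lhs : ℕ → ℚ
lhs n = Σℚ (suc n) (λ k →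
  if (k % 4) ℕ.≡ᵇ 2
  then ℤ→ℚ (+ (n C k) ℤ.* sgn ((k ∸ 2) / 4) ℤ.* (+ 2) ℤ.^ ((3 ℕ.* k) / 2)) ℚ.* B (n ∸ k)
  else ℚ.0ℚ)

-- RHS: (n/2) ((-1)^⌊(n-2)/4⌋ 2^{3n/2-2} - (-1)^{n/2} 2^{n-1} + 4 U_{n-1}(2,5))
-- (an integer, since n is even; n ≥ 2 so all exponents are natural)
rhs : ℕ → ℤ
rhs n = + (n / 2) ℤ.*
  ( sgn ((n ∸ 2) / 4) ℤ.* (+ 2) ℤ.^ ((3 ℕ.* n) / 2 ∸ 2)
    ℤ.- sgn (n / 2) ℤ.* (+ 2) ℤ.^ (n ∸ 1)
    ℤ.+ (+ 4) ℤ.* U (n ∸ 1) (+ 2) (+ 5) )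

-- Work in the Gaussian rationals ℚ(i) with the Bernoulli polynomials
-- Bₙ(x) = Σₖ (n C k) Bₖ xⁿ⁻ᵏ.  The defining recurrence of the Bₖ says
-- Bₙ(1) = Bₙ + [n = 1], and the Appell property Bₙ(x + y) = Σⱼ (n C j) Bⱼ(x) yⁿ⁻ʲ
-- turns this into Bₙ(x + 1) − Bₙ(x) = n xⁿ⁻¹.
--
-- Evaluate W = Bₙ(α) − Bₙ(iα) + Bₙ(−α) − Bₙ(−iα) at α = 2 + 2i in two ways.
-- Expanding, αᵏ − (iα)ᵏ + (−α)ᵏ − (−iα)ᵏ vanishes unless k ≡ 2 (mod 4), where it
-- is 4αᵏ = 4i (−1)^((k−2)/4) 2^(3k/2); so W = 4i · lhs.  On the other hand α = iα + 4
-- and −iα = −α + 4, so telescoping gives W = n Σ_{j<4} ((iα + j)ⁿ⁻¹ − (−α + j)ⁿ⁻¹).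
-- The four differences are over conjugate pairs −2 ± 2i, −1 ± 2i, ±2i, 1 ± 2i and
-- yield the three terms of the right-hand side; 1 ± 2i are the roots of
-- X² − 2X + 5, whence U_{n−1}(2, 5).  Hence 4i · lhs = 4i · rhs.

module Submission where

open import Defs

module IntegerEmbedding where

  open import Data.Nat as ℕ using (suc)
  open import Data.Integer as ℤ using (ℤ; +_; -[1+_])
  import Data.Integer.Properties as ℤ
  open import Data.Rational as ℚ using (ℚ)
  import Data.Rational.Properties as ℚ
  open import Data.Nat.Coprimality as Coprimality using (1-coprimeTo)
  open import Relation.Binary.PropositionalEquality

  private
    mkℚ/1 : ℤ → ℚ
    mkℚ/1 z = ℚ.mkℚ z 0 (Coprimality.sym (1-coprimeTo ℤ.∣ z ∣))

    ℤ→ℚ≡mkℚ/1 : ∀ z → ℤ→ℚ z ≡ mkℚ/1 z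
    ℤ→ℚ≡mkℚ/1 (+ n)    = ℚ.normalize-coprime (Coprimality.sym (1-coprimeTo n))
    ℤ→ℚ≡mkℚ/1 -[1+ n ] = cong ℚ.-_ (ℚ.normalize-coprime (Coprimality.sym (1-coprimeTo (suc n))))

  ℤ→ℚ-homo-+ : ∀ a b → ℤ→ℚ (a ℤ.+ b) ≡ ℤ→ℚ a ℚ.+ ℤ→ℚ b
  ℤ→ℚ-homo-+ a b rewrite ℤ→ℚ≡mkℚ/1 a | ℤ→ℚ≡mkℚ/1 b =
    cong ℤ→ℚ (cong₂ ℤ._+_ (sym (ℤ.*-identityʳ a)) (sym (ℤ.*-identityʳ b)))

  ℤ→ℚ-homo-* : ∀ a b → ℤ→ℚ (a ℤ.* b) ≡ ℤ→ℚ a ℚ.* ℤ→ℚ b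
  ℤ→ℚ-homo-* a b rewrite ℤ→ℚ≡mkℚ/1 a | ℤ→ℚ≡mkℚ/1 b = refl

  ℤ→ℚ-homo‿- : ∀ a → ℤ→ℚ (ℤ.- a) ≡ ℚ.- ℤ→ℚ a
  ℤ→ℚ-homo‿- a rewrite ℤ→ℚ≡mkℚ/1 a | ℤ→ℚ≡mkℚ/1 (ℤ.- a) = neg-mkℚ a
    where
    neg-mkℚ : ∀ a → mkℚ/1 (ℤ.- a) ≡ ℚ.- mkℚ/1 a
    neg-mkℚ (+ ℕ.zero) = refl
    neg-mkℚ (+ suc n)  = refl
    neg-mkℚ -[1+ n ]   = refl

  [1+n]*1/[1+n]≡1 : ∀ n → ℤ→ℚ (+ suc n) ℚ.* ((+ 1) ℚ./ suc n) ≡ ℚ.1ℚ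
  [1+n]*1/[1+n]≡1 n = trans
    (cong₂ ℚ._*_ (ℤ→ℚ≡mkℚ/1 (+ suc n)) (ℚ.normalize-coprime (1-coprimeTo (suc n))))
    (ℚ.*-inverseʳ (mkℚ/1 (+ suc n)))

module GaussianRationals where

  open import Data.Rational as ℚ using (ℚ)
  import Data.Rational.Properties as ℚ
  open import Data.Rational.Solver using (module +-*-Solver)
  open import Data.Integer as ℤ using (ℤ; +_)
  import Data.Nat as ℕ
  import Data.Integer.Properties as ℤ
  open IntegerEmbedding
  open import Algebra.Bundles using (CommutativeRing)
  open import Algebra.Structures using (IsCommutativeRing)
  import Algebra.Solver.Ring.AlmostCommutativeRing as ACR
  import Algebra.Solver.Ring.Simple as RingSolver
  import Algebra.Properties.CommutativeSemiring.Exp as Exp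
  open import Data.Product using (_,_)
  open import Relation.Nullary using (Dec; yes; no)
  open import Relation.Binary.PropositionalEquality

  infix 9 _+i_
  record ℚ[i] : Set where
    no-eta-equality; pattern
    constructor _+i_
    field
      re im : ℚ
  open ℚ[i] public

  infix  8 -_
  infixl 7 _*_
  infixl 6 _+_ _-_

  _+_ : ℚ[i] → ℚ[i] → ℚ[i]
  (a +i b) + (c +i d) = (a ℚ.+ c) +i (b ℚ.+ d)

  _*_ : ℚ[i] → ℚ[i] → ℚ[i]
  (a +i b) * (c +i d) = (a ℚ.* c ℚ.- b ℚ.* d) +i (a ℚ.* d ℚ.+ b ℚ.* c)

  -_ : ℚ[i] → ℚ[i]
  - (a +i b) = (ℚ.- a) +i (ℚ.- b)

  _-_ : ℚ[i] → ℚ[i] → ℚ[i]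
  x - y = x + - y

  0# 1# : ℚ[i]
  0# = ℚ.0ℚ +i ℚ.0ℚ
  1# = ℚ.1ℚ +i ℚ.0ℚ

  module RingLaws where
    open +-*-Solver

    +-assoc : ∀ x y z → x + y + z ≡ x + (y + z)
    +-assoc (a +i b) (c +i d) (e +i f) = cong₂ _+i_ (ℚ.+-assoc a c e) (ℚ.+-assoc b d f)

    +-comm : ∀ x y → x + y ≡ y + x
    +-comm (a +i b) (c +i d) = cong₂ _+i_ (ℚ.+-comm a c) (ℚ.+-comm b d)

    +-identityˡ : ∀ x → 0# + x ≡ x
    +-identityˡ (a +i b) = cong₂ _+i_ (ℚ.+-identityˡ a) (ℚ.+-identityˡ b)

    +-identityʳ : ∀ x → x + 0# ≡ x
    +-identityʳ x = trans (+-comm x 0#) (+-identityˡ x)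

    -‿inverseˡ : ∀ x → - x + x ≡ 0#
    -‿inverseˡ (a +i b) = cong₂ _+i_ (ℚ.+-inverseˡ a) (ℚ.+-inverseˡ b)

    -‿inverseʳ : ∀ x → x - x ≡ 0#
    -‿inverseʳ x = trans (+-comm x (- x)) (-‿inverseˡ x)

    *-comm : ∀ x y → x * y ≡ y * x
    *-comm (a +i b) (c +i d) = cong₂ _+i_
      (solve 4 (λ a b c d → a :* c :- b :* d := c :* a :- d :* b) refl a b c d)
      (solve 4 (λ a b c d → a :* d :+ b :* c := c :* b :+ d :* a) refl a b c d)

    *-assoc : ∀ x y z → x * y * z ≡ x * (y * z)
    *-assoc (a +i b) (c +i d) (e +i f) = cong₂ _+i_
      (solve 6 (λ a b c d e f → (a :* c :- b :* d) :* e :- (a :* d :+ b :* c) :* f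
                              := a :* (c :* e :- d :* f) :- b :* (c :* f :+ d :* e)) refl a b c d e f)
      (solve 6 (λ a b c d e f → (a :* c :- b :* d) :* f :+ (a :* d :+ b :* c) :* e
                              := a :* (c :* f :+ d :* e) :+ b :* (c :* e :- d :* f)) refl a b c d e f)

    *-identityˡ : ∀ x → 1# * x ≡ x
    *-identityˡ (a +i b) = cong₂ _+i_
      (solve 2 (λ a b → con ℚ.1ℚ :* a :- con ℚ.0ℚ :* b := a) refl a b)
      (solve 2 (λ a b → con ℚ.1ℚ :* b :+ con ℚ.0ℚ :* a := b) refl a b)

    *-identityʳ : ∀ x → x * 1# ≡ x
    *-identityʳ x = trans (*-comm x 1#) (*-identityˡ x)

    *-distribˡ-+ : ∀ x y z → x * (y + z) ≡ x * y + x * z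
    *-distribˡ-+ (a +i b) (c +i d) (e +i f) = cong₂ _+i_
      (solve 6 (λ a b c d e f → a :* (c :+ e) :- b :* (d :+ f)
                              := (a :* c :- b :* d) :+ (a :* e :- b :* f)) refl a b c d e f)
      (solve 6 (λ a b c d e f → a :* (d :+ f) :+ b :* (c :+ e)
                              := (a :* d :+ b :* c) :+ (a :* f :+ b :* e)) refl a b c d e f)

    *-distribʳ-+ : ∀ x y z → (y + z) * x ≡ y * x + z * x
    *-distribʳ-+ x y z = begin
      (y + z) * x      ≡⟨ *-comm (y + z) x ⟩
      x * (y + z)      ≡⟨ *-distribˡ-+ x y z ⟩
      x * y + x * z    ≡⟨ cong₂ _+_ (*-comm x y) (*-comm x z) ⟩
      y * x + z * x    ∎
      where open ≡-Reasoning

  open RingLaws public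

  isCommutativeRing : IsCommutativeRing _≡_ _+_ _*_ -_ 0# 1#
  isCommutativeRing = record
    { isRing = record
      { +-isAbelianGroup = record
        { isGroup = record
          { isMonoid = record
            { isSemigroup = record
              { isMagma = record { isEquivalence = isEquivalence ; ∙-cong = cong₂ _+_ }
              ; assoc = +-assoc }
            ; identity = +-identityˡ , +-identityʳ }
          ; inverse = -‿inverseˡ , -‿inverseʳ
          ; ⁻¹-cong = cong (-_) }
        ; comm = +-comm }
      ; *-cong = cong₂ _*_
      ; *-assoc = *-assoc
      ; *-identity = *-identityˡ , *-identityʳ
      ; distrib = *-distribˡ-+ , *-distribʳ-+ }
    ; *-comm = *-comm }

  commutativeRing : CommutativeRing _ _
  commutativeRing = record { isCommutativeRing = isCommutativeRing }

  open Exp (CommutativeRing.commutativeSemiring commutativeRing) public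
    using (_^_; ^-homo-*; ^-assocʳ; ^-distrib-*)

  *-cancelˡ : ∀ {c c⁻¹} x y → c⁻¹ * c ≡ 1# → c * x ≡ c * y → x ≡ y
  *-cancelˡ {c} {c⁻¹} x y c⁻¹c≡1 cx≡cy = begin
    x                ≡⟨ *-identityˡ x ⟨
    1# * x           ≡⟨ cong (_* x) c⁻¹c≡1 ⟨
    c⁻¹ * c * x      ≡⟨ *-assoc c⁻¹ c x ⟩
    c⁻¹ * (c * x)    ≡⟨ cong (c⁻¹ *_) cx≡cy ⟩
    c⁻¹ * (c * y)    ≡⟨ *-assoc c⁻¹ c y ⟨
    c⁻¹ * c * y      ≡⟨ cong (_* y) c⁻¹c≡1 ⟩
    1# * y           ≡⟨ *-identityˡ y ⟩
    y                ∎
    where open ≡-Reasoning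

  _≟_ : (x y : ℚ[i]) → Dec (x ≡ y)
  (a +i b) ≟ (c +i d) with a ℚ.≟ c | b ℚ.≟ d
  ... | yes a≡c | yes b≡d = yes (cong₂ _+i_ a≡c b≡d)
  ... | no a≢c  | _       = no (λ x≡y → a≢c (cong re x≡y))
  ... | yes _   | no b≢d  = no (λ x≡y → b≢d (cong im x≡y))

  open RingSolver (ACR.fromCommutativeRing commutativeRing) _≟_ public
    using (solve; _:=_; con; _:+_; _:*_; _:-_; :-_)

  1#^n≡1# : ∀ n → 1# ^ n ≡ 1#
  1#^n≡1# ℕ.zero    = refl
  1#^n≡1# (ℕ.suc n) = trans (cong (1# *_) (1#^n≡1# n)) (*-identityˡ 1#)

  -‿^-even : ∀ x m → (- x) ^ (m ℕ.* 2) ≡ x ^ (m ℕ.* 2)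
  -‿^-even x ℕ.zero    = refl
  -‿^-even x (ℕ.suc m) = begin
    - x * (- x * (- x) ^ (m ℕ.* 2)) ≡⟨ cong (λ t → - x * (- x * t)) (-‿^-even x m) ⟩
    - x * (- x * x ^ (m ℕ.* 2))     ≡⟨ solve 2 (λ x y → :- x :* (:- x :* y) := x :* (x :* y)) refl x (x ^ (m ℕ.* 2)) ⟩
    x * (x * x ^ (m ℕ.* 2))         ∎
    where open ≡-Reasoning

  -‿^-odd : ∀ x m → (- x) ^ ℕ.suc (m ℕ.* 2) ≡ - x ^ ℕ.suc (m ℕ.* 2)
  -‿^-odd x m = trans (cong (- x *_) (-‿^-even x m)) (solve 2 (λ x y → :- x :* y := :- (x :* y)) refl x (x ^ (m ℕ.* 2)))

  fromℚ : ℚ → ℚ[i]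
  fromℚ q = q +i ℚ.0ℚ

  fromℚ-homo-+ : ∀ p q → fromℚ (p ℚ.+ q) ≡ fromℚ p + fromℚ q
  fromℚ-homo-+ p q = refl

  fromℚ-homo-* : ∀ p q → fromℚ (p ℚ.* q) ≡ fromℚ p * fromℚ q
  fromℚ-homo-* p q = cong₂ _+i_
    (sym (trans (cong (p ℚ.* q ℚ.+_) (cong ℚ.-_ (ℚ.*-zeroˡ ℚ.0ℚ))) (ℚ.+-identityʳ (p ℚ.* q))))
    (sym (trans (cong₂ ℚ._+_ (ℚ.*-zeroʳ p) (ℚ.*-zeroˡ q)) (ℚ.+-identityʳ ℚ.0ℚ)))

  fromℤ : ℤ → ℚ[i]
  fromℤ z = fromℚ (ℤ→ℚ z)

  fromℤ-homo-+ : ∀ a b → fromℤ (a ℤ.+ b) ≡ fromℤ a + fromℤ b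
  fromℤ-homo-+ a b = trans (cong fromℚ (ℤ→ℚ-homo-+ a b)) (fromℚ-homo-+ (ℤ→ℚ a) (ℤ→ℚ b))

  fromℤ-homo-* : ∀ a b → fromℤ (a ℤ.* b) ≡ fromℤ a * fromℤ b
  fromℤ-homo-* a b = trans (cong fromℚ (ℤ→ℚ-homo-* a b)) (fromℚ-homo-* (ℤ→ℚ a) (ℤ→ℚ b))

  fromℤ-homo‿- : ∀ a → fromℤ (ℤ.- a) ≡ - fromℤ a
  fromℤ-homo‿- a = cong fromℚ (ℤ→ℚ-homo‿- a)

  fromℤ-homo-^ : ∀ a n → fromℤ (a ℤ.^ n) ≡ fromℤ a ^ n
  fromℤ-homo-^ a ℕ.zero    = refl
  fromℤ-homo-^ a (ℕ.suc n) = trans (fromℤ-homo-* a (a ℤ.^ n)) (cong (fromℤ a *_) (fromℤ-homo-^ a n))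

  fromℕ : ℕ.ℕ → ℚ[i]
  fromℕ n = fromℤ (+ n)

  fromℕ-homo-+ : ∀ m n → fromℕ (m ℕ.+ n) ≡ fromℕ m + fromℕ n
  fromℕ-homo-+ m n = fromℤ-homo-+ (+ m) (+ n)

  fromℕ-homo-* : ∀ m n → fromℕ (m ℕ.* n) ≡ fromℕ m * fromℕ n
  fromℕ-homo-* m n = trans (cong fromℤ (ℤ.pos-* m n)) (fromℤ-homo-* (+ m) (+ n))

module LucasSequences where

  open GaussianRationals
  open import Data.Nat as ℕ using (ℕ; zero; suc)
  open import Data.Integer as ℤ using (ℤ)
  open import Relation.Binary.PropositionalEquality
  open ≡-Reasoning

  module _ (p q : ℤ) {x : ℚ[i]} (root : x * x ≡ fromℤ p * x - fromℤ q) where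

    ^-suc≡U : ∀ k → x ^ suc k ≡ x * fromℤ (U (suc k) p q) - fromℤ q * fromℤ (U k p q)
    ^-suc≡U zero    = solve 2 (λ x c → x :* con 1# := x :* con 1# :- c :* con 0#) refl x (fromℤ q)
    ^-suc≡U (suc k) = begin
      x * x ^ suc k
        ≡⟨ cong (x *_) (^-suc≡U k) ⟩
      x * (x * u₁ - fromℤ q * u₀)
        ≡⟨ solve 4 (λ x u₁ u₀ c → x :* (x :* u₁ :- c :* u₀) := (x :* x) :* u₁ :- x :* c :* u₀) refl x u₁ u₀ (fromℤ q) ⟩
      x * x * u₁ - x * fromℤ q * u₀
        ≡⟨ cong (λ t → t * u₁ - x * fromℤ q * u₀) root ⟩
      (fromℤ p * x - fromℤ q) * u₁ - x * fromℤ q * u₀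
        ≡⟨ solve 5 (λ x u₁ u₀ a c → (a :* x :- c) :* u₁ :- x :* c :* u₀ := x :* (a :* u₁ :- c :* u₀) :- c :* u₁)
             refl x u₁ u₀ (fromℤ p) (fromℤ q) ⟩
      x * (fromℤ p * u₁ - fromℤ q * u₀) - fromℤ q * u₁
        ≡⟨ cong (λ t → x * t - fromℤ q * u₁) (sym U-step) ⟩
      x * fromℤ (U (suc (suc k)) p q) - fromℤ q * u₁ ∎
      where
      u₀ u₁ : ℚ[i]
      u₀ = fromℤ (U k p q)
      u₁ = fromℤ (U (suc k) p q)
      U-step : fromℤ (U (suc (suc k)) p q) ≡ fromℤ p * u₁ - fromℤ q * u₀
      U-step = begin
        fromℤ (p ℤ.* U (suc k) p q ℤ.- q ℤ.* U k p q)
          ≡⟨ fromℤ-homo-+ (p ℤ.* U (suc k) p q) (ℤ.- (q ℤ.* U k p q)) ⟩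
        fromℤ (p ℤ.* U (suc k) p q) + fromℤ (ℤ.- (q ℤ.* U k p q))
          ≡⟨ cong₂ _+_ (fromℤ-homo-* p (U (suc k) p q))
                       (trans (fromℤ-homo‿- (q ℤ.* U k p q)) (cong -_ (fromℤ-homo-* q (U k p q)))) ⟩
        fromℤ p * u₁ - fromℤ q * u₀ ∎

  ^-difference≡U : ∀ p q {x y} → x * x ≡ fromℤ p * x - fromℤ q → y * y ≡ fromℤ p * y - fromℤ q →
    ∀ k → x ^ k - y ^ k ≡ (x - y) * fromℤ (U k p q)
  ^-difference≡U p q {x} {y} x-root y-root zero    = solve 2 (λ x y → con 1# :- con 1# := (x :- y) :* con 0#) refl x y
  ^-difference≡U p q {x} {y} x-root y-root (suc k) = begin
    x ^ suc k - y ^ suc k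
      ≡⟨ cong₂ _-_ (^-suc≡U p q x-root k) (^-suc≡U p q y-root k) ⟩
    (x * u₁ - c) - (y * u₁ - c)
      ≡⟨ solve 4 (λ x y u c → (x :* u :- c) :- (y :* u :- c) := (x :- y) :* u) refl x y u₁ c ⟩
    (x - y) * u₁ ∎
    where
    u₁ c : ℚ[i]
    u₁ = fromℤ (U (suc k) p q)
    c  = fromℤ q * fromℤ (U k p q)

module BinomialSums where

  open GaussianRationals
  open import Data.Nat as ℕ using (ℕ; zero; suc; _∸_; _<_; z≤n; s≤s)
  import Data.Nat.Properties as ℕ
  open import Data.Nat.Combinatorics using (_C_; nCk+nC[k+1]≡[n+1]C[k+1]; k>n⇒nCk≡0)
  open import Relation.Binary.PropositionalEquality
  open ≡-Reasoning

  ∑ : ℕ → (ℕ → ℚ[i]) → ℚ[i]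
  ∑ zero    f = 0#
  ∑ (suc n) f = f 0 + ∑ n (λ k → f (suc k))

  ∑-cong-< : ∀ n {f g : ℕ → ℚ[i]} → (∀ {k} → k < n → f k ≡ g k) → ∑ n f ≡ ∑ n g
  ∑-cong-< zero    f≡g = refl
  ∑-cong-< (suc n) f≡g = cong₂ _+_ (f≡g (s≤s z≤n)) (∑-cong-< n (λ k<n → f≡g (s≤s k<n)))

  ∑-cong : ∀ n {f g : ℕ → ℚ[i]} → (∀ k → f k ≡ g k) → ∑ n f ≡ ∑ n g
  ∑-cong n f≡g = ∑-cong-< n (λ {k} _ → f≡g k)

  ∑-zero : ∀ n {f : ℕ → ℚ[i]} → (∀ k → f k ≡ 0#) → ∑ n f ≡ 0#
  ∑-zero zero    f≡0 = refl
  ∑-zero (suc n) f≡0 = trans (cong₂ _+_ (f≡0 0) (∑-zero n (λ k → f≡0 (suc k)))) (+-identityʳ 0#)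

  ∑-distrib-+ : ∀ n (f g : ℕ → ℚ[i]) → ∑ n (λ k → f k + g k) ≡ ∑ n f + ∑ n g
  ∑-distrib-+ zero    f g = solve 0 (con 0# := con 0# :+ con 0#) refl
  ∑-distrib-+ (suc n) f g = begin
    f 0 + g 0 + ∑ n (λ k → f (suc k) + g (suc k))
      ≡⟨ cong (f 0 + g 0 +_) (∑-distrib-+ n (λ k → f (suc k)) (λ k → g (suc k))) ⟩
    f 0 + g 0 + (∑ n (λ k → f (suc k)) + ∑ n (λ k → g (suc k)))
      ≡⟨ solve 4 (λ a b c d → a :+ b :+ (c :+ d) := a :+ c :+ (b :+ d)) refl (f 0) (g 0) _ _ ⟩
    f 0 + ∑ n (λ k → f (suc k)) + (g 0 + ∑ n (λ k → g (suc k))) ∎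

  ∑-distrib-minus : ∀ n (f g : ℕ → ℚ[i]) → ∑ n (λ k → f k - g k) ≡ ∑ n f - ∑ n g
  ∑-distrib-minus zero    f g = solve 0 (con 0# := con 0# :- con 0#) refl
  ∑-distrib-minus (suc n) f g = begin
    f 0 - g 0 + ∑ n (λ k → f (suc k) - g (suc k))
      ≡⟨ cong (f 0 - g 0 +_) (∑-distrib-minus n (λ k → f (suc k)) (λ k → g (suc k))) ⟩
    f 0 - g 0 + (∑ n (λ k → f (suc k)) - ∑ n (λ k → g (suc k)))
      ≡⟨ solve 4 (λ a b c d → a :- b :+ (c :- d) := a :+ c :- (b :+ d)) refl (f 0) (g 0) _ _ ⟩
    f 0 + ∑ n (λ k → f (suc k)) - (g 0 + ∑ n (λ k → g (suc k))) ∎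

  *-∑ : ∀ n c (f : ℕ → ℚ[i]) → c * ∑ n f ≡ ∑ n (λ k → c * f k)
  *-∑ zero    c f = solve 1 (λ c → c :* con 0# := con 0#) refl c
  *-∑ (suc n) c f = begin
    c * (f 0 + ∑ n (λ k → f (suc k)))
      ≡⟨ solve 3 (λ c a s → c :* (a :+ s) := c :* a :+ c :* s) refl c (f 0) _ ⟩
    c * f 0 + c * ∑ n (λ k → f (suc k))
      ≡⟨ cong (c * f 0 +_) (*-∑ n c (λ k → f (suc k))) ⟩
    c * f 0 + ∑ n (λ k → c * f (suc k)) ∎

  ∑-suc-last : ∀ n (f : ℕ → ℚ[i]) → ∑ (suc n) f ≡ ∑ n f + f n
  ∑-suc-last zero    f = solve 1 (λ a → a :+ con 0# := con 0# :+ a) refl (f 0)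
  ∑-suc-last (suc n) f = begin
    f 0 + ∑ (suc n) (λ k → f (suc k))
      ≡⟨ cong (f 0 +_) (∑-suc-last n (λ k → f (suc k))) ⟩
    f 0 + (∑ n (λ k → f (suc k)) + f (suc n))
      ≡⟨ solve 3 (λ a s b → a :+ (s :+ b) := a :+ s :+ b) refl (f 0) _ (f (suc n)) ⟩
    f 0 + ∑ n (λ k → f (suc k)) + f (suc n) ∎

  ∑-pascal : ∀ n (f : ℕ → ℚ[i]) →
    ∑ (suc (suc n)) (λ k → fromℕ (suc n C k) * f k)
      ≡ ∑ (suc n) (λ k → fromℕ (n C k) * f k) + ∑ (suc n) (λ k → fromℕ (n C k) * f (suc k))
  ∑-pascal n f = begin
    fromℕ 1 * f 0 + ∑ (suc n) (λ k → fromℕ (suc n C suc k) * f (suc k))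
      ≡⟨ cong (fromℕ 1 * f 0 +_) (∑-cong (suc n) split) ⟩
    fromℕ 1 * f 0 + ∑ (suc n) (λ k → fromℕ (n C k) * f (suc k) + fromℕ (n C suc k) * f (suc k))
      ≡⟨ cong (fromℕ 1 * f 0 +_) (∑-distrib-+ (suc n) (λ k → fromℕ (n C k) * f (suc k)) (λ k → fromℕ (n C suc k) * f (suc k))) ⟩
    fromℕ 1 * f 0 + (R + ∑ (suc n) (λ k → fromℕ (n C suc k) * f (suc k)))
      ≡⟨ cong (λ s → fromℕ 1 * f 0 + (R + s)) (∑-suc-last n (λ k → fromℕ (n C suc k) * f (suc k))) ⟩
    fromℕ 1 * f 0 + (R + (L + fromℕ (n C suc n) * f (suc n)))
      ≡⟨ cong (λ c → fromℕ 1 * f 0 + (R + (L + fromℕ c * f (suc n)))) (k>n⇒nCk≡0 (ℕ.n<1+n n)) ⟩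
    fromℕ 1 * f 0 + (R + (L + fromℕ 0 * f (suc n)))
      ≡⟨ solve 4 (λ a r l b → a :+ (r :+ (l :+ con 0# :* b)) := a :+ l :+ r) refl (fromℕ 1 * f 0) R L (f (suc n)) ⟩
    fromℕ 1 * f 0 + L + R ∎
    where
    R = ∑ (suc n) (λ k → fromℕ (n C k) * f (suc k))
    L = ∑ n (λ k → fromℕ (n C suc k) * f (suc k))
    split : ∀ k → fromℕ (suc n C suc k) * f (suc k) ≡ fromℕ (n C k) * f (suc k) + fromℕ (n C suc k) * f (suc k)
    split k = begin
      fromℕ (suc n C suc k) * f (suc k)
        ≡⟨ cong (λ c → fromℕ c * f (suc k)) (sym (nCk+nC[k+1]≡[n+1]C[k+1] n k)) ⟩
      fromℕ (n C k ℕ.+ n C suc k) * f (suc k)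
        ≡⟨ cong (_* f (suc k)) (fromℕ-homo-+ (n C k) (n C suc k)) ⟩
      (fromℕ (n C k) + fromℕ (n C suc k)) * f (suc k)
        ≡⟨ solve 3 (λ a b x → (a :+ b) :* x := a :* x :+ b :* x) refl (fromℕ (n C k)) (fromℕ (n C suc k)) (f (suc k)) ⟩
      fromℕ (n C k) * f (suc k) + fromℕ (n C suc k) * f (suc k) ∎

  conv : ℕ → (ℕ → ℚ[i]) → (ℕ → ℚ[i]) → ℚ[i]
  conv n u v = ∑ (suc n) (λ k → fromℕ (n C k) * (u k * v (n ∸ k)))

  conv-cong-left : ∀ n {u u′ : ℕ → ℚ[i]} (v : ℕ → ℚ[i]) → (∀ k → u k ≡ u′ k) → conv n u v ≡ conv n u′ v
  conv-cong-left n v u≡u′ = ∑-cong (suc n) (λ k → cong (λ a → fromℕ (n C k) * (a * v (n ∸ k))) (u≡u′ k))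

  conv-suc : ∀ n (u v : ℕ → ℚ[i]) →
    conv (suc n) u v ≡ conv n u (λ k → v (suc k)) + conv n (λ k → u (suc k)) v
  conv-suc n u v = trans (∑-pascal n (λ k → u k * v (suc n ∸ k)))
    (cong (_+ conv n (λ k → u (suc k)) v) (∑-cong-< (suc n) (λ {k} k≤n →
      cong (λ j → fromℕ (n C k) * (u k * v j)) (ℕ.+-∸-assoc 1 (ℕ.s≤s⁻¹ k≤n)))))

  *-conv-left : ∀ n c (u v : ℕ → ℚ[i]) → c * conv n u v ≡ conv n (λ k → c * u k) v
  *-conv-left n c u v = trans (*-∑ (suc n) c (λ k → fromℕ (n C k) * (u k * v (n ∸ k)))) (∑-cong (suc n) (λ k →
    solve 4 (λ c b x y → c :* (b :* (x :* y)) := b :* ((c :* x) :* y)) refl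
      c (fromℕ (n C k)) (u k) (v (n ∸ k))))

  *-conv-right : ∀ n c (u v : ℕ → ℚ[i]) → c * conv n u v ≡ conv n u (λ k → c * v k)
  *-conv-right n c u v = trans (*-∑ (suc n) c (λ k → fromℕ (n C k) * (u k * v (n ∸ k)))) (∑-cong (suc n) (λ k →
    solve 4 (λ c b x y → c :* (b :* (x :* y)) := b :* (x :* (c :* y))) refl
      c (fromℕ (n C k)) (u k) (v (n ∸ k))))

  conv-+-left : ∀ n (u u′ v : ℕ → ℚ[i]) → conv n (λ k → u k + u′ k) v ≡ conv n u v + conv n u′ v
  conv-+-left n u u′ v = trans (∑-cong (suc n) (λ k →
    solve 4 (λ b x x′ y → b :* ((x :+ x′) :* y) := b :* (x :* y) :+ b :* (x′ :* y)) refl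
      (fromℕ (n C k)) (u k) (u′ k) (v (n ∸ k))))
    (∑-distrib-+ (suc n) (λ k → fromℕ (n C k) * (u k * v (n ∸ k))) (λ k → fromℕ (n C k) * (u′ k * v (n ∸ k))))

  conv-minus-left : ∀ n (u u′ v : ℕ → ℚ[i]) → conv n (λ k → u k - u′ k) v ≡ conv n u v - conv n u′ v
  conv-minus-left n u u′ v = trans (∑-cong (suc n) (λ k →
    solve 4 (λ b x x′ y → b :* ((x :- x′) :* y) := b :* (x :* y) :- b :* (x′ :* y)) refl
      (fromℕ (n C k)) (u k) (u′ k) (v (n ∸ k))))
    (∑-distrib-minus (suc n) (λ k → fromℕ (n C k) * (u k * v (n ∸ k))) (λ k → fromℕ (n C k) * (u′ k * v (n ∸ k))))

module AppellPolynomials where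

  open GaussianRationals
  open BinomialSums
  open import Data.Nat as ℕ using (ℕ; zero; suc; _∸_)
  open import Data.Nat.Combinatorics using (_C_; nC1≡n)
  open import Relation.Binary.PropositionalEquality
  open ≡-Reasoning

  -- P b n x = Σₖ (n C k) bₖ xⁿ⁻ᵏ, the umbral (E + x)ⁿ with Eᵏ = bₖ; the
  -- recursion (E + x)ⁿ⁺¹ = E (E + x)ⁿ + x (E + x)ⁿ is what makes induction work.
  P : (ℕ → ℚ[i]) → ℕ → ℚ[i] → ℚ[i]
  P b zero    x = b 0
  P b (suc n) x = P (λ k → b (suc k)) n x + x * P b n x

  private
    conv-zero : ∀ (u v : ℕ → ℚ[i]) → conv 0 u v ≡ u 0 * v 0
    conv-zero u v = solve 2 (λ a c → con 1# :* (a :* c) :+ con 0# := a :* c) refl (u 0) (v 0)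

  P≡conv-coefficients : ∀ b n x → P b n x ≡ conv n b (x ^_)
  P≡conv-coefficients b zero    x = sym (trans (conv-zero b (x ^_)) (*-identityʳ (b 0)))
  P≡conv-coefficients b (suc n) x = begin
    P (λ k → b (suc k)) n x + x * P b n x
      ≡⟨ cong₂ _+_ (P≡conv-coefficients (λ k → b (suc k)) n x) (cong (x *_) (P≡conv-coefficients b n x)) ⟩
    conv n (λ k → b (suc k)) (x ^_) + x * conv n b (x ^_)
      ≡⟨ cong (conv n (λ k → b (suc k)) (x ^_) +_) (*-conv-right n x b (x ^_)) ⟩
    conv n (λ k → b (suc k)) (x ^_) + conv n b (λ k → x ^ suc k)
      ≡⟨ +-comm _ _ ⟩
    conv n b (λ k → x ^ suc k) + conv n (λ k → b (suc k)) (x ^_)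
      ≡⟨ sym (conv-suc n b (x ^_)) ⟩
    conv (suc n) b (x ^_) ∎

  P≡conv-powers : ∀ b n x → P b n x ≡ conv n (x ^_) b
  P≡conv-powers b zero    x = sym (trans (conv-zero (x ^_) b) (*-identityˡ (b 0)))
  P≡conv-powers b (suc n) x = begin
    P (λ k → b (suc k)) n x + x * P b n x
      ≡⟨ cong₂ _+_ (P≡conv-powers (λ k → b (suc k)) n x) (cong (x *_) (P≡conv-powers b n x)) ⟩
    conv n (x ^_) (λ k → b (suc k)) + x * conv n (x ^_) b
      ≡⟨ cong (conv n (x ^_) (λ k → b (suc k)) +_) (*-conv-left n x (x ^_) b) ⟩
    conv n (x ^_) (λ k → b (suc k)) + conv n (λ k → x ^ suc k) b
      ≡⟨ sym (conv-suc n (x ^_) b) ⟩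
    conv (suc n) (x ^_) b ∎

  P-+ : ∀ b n x y → P b n (x + y) ≡ conv n (λ j → P b j x) (y ^_)
  P-+ b zero    x y = sym (trans (conv-zero (λ j → P b j x) (y ^_)) (*-identityʳ (b 0)))
  P-+ b (suc n) x y = begin
    P (λ k → b (suc k)) n (x + y) + (x + y) * P b n (x + y)
      ≡⟨ cong₂ (λ s t → s + (x + y) * t) (P-+ (λ k → b (suc k)) n x y) (P-+ b n x y) ⟩
    S′ + (x + y) * S
      ≡⟨ solve 4 (λ a c x y → a :+ (x :+ y) :* c := y :* c :+ (a :+ x :* c)) refl S′ S x y ⟩
    y * S + (S′ + x * S)
      ≡⟨ cong₂ (λ s t → s + (S′ + t)) (*-conv-right n y (λ j → P b j x) (y ^_))
                                       (*-conv-left n x (λ j → P b j x) (y ^_)) ⟩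
    conv n (λ j → P b j x) (λ k → y ^ suc k) + (S′ + conv n (λ j → x * P b j x) (y ^_))
      ≡⟨ cong (conv n (λ j → P b j x) (λ k → y ^ suc k) +_)
           (sym (conv-+-left n (λ j → P (λ k → b (suc k)) j x) (λ j → x * P b j x) (y ^_))) ⟩
    conv n (λ j → P b j x) (λ k → y ^ suc k) + conv n (λ j → P b (suc j) x) (y ^_)
      ≡⟨ sym (conv-suc n (λ j → P b j x) (y ^_)) ⟩
    conv (suc n) (λ j → P b j x) (y ^_) ∎
    where
    S S′ : ℚ[i]
    S  = conv n (λ j → P b j x) (y ^_)
    S′ = conv n (λ j → P (λ k → b (suc k)) j x) (y ^_)

  δ₁ : ℕ → ℚ[i]
  δ₁ 1 = 1#
  δ₁ _ = 0#

  conv-δ₁ : ∀ n x → conv (suc n) δ₁ (x ^_) ≡ fromℕ (suc n) * x ^ n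
  conv-δ₁ n x = begin
    fromℕ 1 * (0# * x ^ suc n) + (fromℕ (suc n C 1) * (1# * x ^ n) + Z)
      ≡⟨ cong₂ (λ c z → fromℕ 1 * (0# * x ^ suc n) + (fromℕ c * (1# * x ^ n) + z))
               (nC1≡n (suc n)) (∑-zero n (λ k → solve 2 (λ c y → c :* (con 0# :* y) := con 0#) refl _ _)) ⟩
    fromℕ 1 * (0# * x ^ suc n) + (fromℕ (suc n) * (1# * x ^ n) + 0#)
      ≡⟨ solve 3 (λ a c y → con 1# :* (con 0# :* a) :+ (c :* (con 1# :* y) :+ con 0#) := c :* y) refl
           (x ^ suc n) (fromℕ (suc n)) (x ^ n) ⟩
    fromℕ (suc n) * x ^ n ∎
    where
    Z : ℚ[i]
    Z = ∑ n (λ k → fromℕ (suc n C suc (suc k)) * (0# * x ^ (n ∸ suc k)))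

  module _ (b : ℕ → ℚ[i]) (P-at-1 : ∀ j → P b j 1# ≡ b j + δ₁ j) where

    P-difference : ∀ n x → P b (suc n) (1# + x) ≡ P b (suc n) x + fromℕ (suc n) * x ^ n
    P-difference n x = begin
      P b (suc n) (1# + x)                            ≡⟨ P-+ b (suc n) 1# x ⟩
      conv (suc n) (λ j → P b j 1#) (x ^_)            ≡⟨ conv-cong-left (suc n) (x ^_) P-at-1 ⟩
      conv (suc n) (λ j → b j + δ₁ j) (x ^_)          ≡⟨ conv-+-left (suc n) b δ₁ (x ^_) ⟩
      conv (suc n) b (x ^_) + conv (suc n) δ₁ (x ^_)  ≡⟨ cong₂ _+_ (sym (P≡conv-coefficients b (suc n) x)) (conv-δ₁ n x) ⟩
      P b (suc n) x + fromℕ (suc n) * x ^ n           ∎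

    P-shift : ∀ n x k →
      P b (suc n) (x + fromℕ k) ≡ P b (suc n) x + fromℕ (suc n) * ∑ k (λ j → (x + fromℕ j) ^ n)
    P-shift n x zero = trans (cong (P b (suc n)) (+-identityʳ x))
      (solve 2 (λ p c → p := p :+ c :* con 0#) refl (P b (suc n) x) (fromℕ (suc n)))
    P-shift n x (suc k) = begin
      P b (suc n) (x + fromℕ (suc k))
        ≡⟨ cong (P b (suc n)) x+[1+k]≡1+[x+k] ⟩
      P b (suc n) (1# + (x + fromℕ k))
        ≡⟨ P-difference n (x + fromℕ k) ⟩
      P b (suc n) (x + fromℕ k) + c * (x + fromℕ k) ^ n
        ≡⟨ cong (_+ c * (x + fromℕ k) ^ n) (P-shift n x k) ⟩
      P b (suc n) x + c * ∑ k f + c * f k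
        ≡⟨ solve 4 (λ p c s t → p :+ c :* s :+ c :* t := p :+ c :* (s :+ t)) refl (P b (suc n) x) c (∑ k f) (f k) ⟩
      P b (suc n) x + c * (∑ k f + f k)
        ≡⟨ cong (λ s → P b (suc n) x + c * s) (sym (∑-suc-last k f)) ⟩
      P b (suc n) x + c * ∑ (suc k) f ∎
      where
      c : ℚ[i]
      c = fromℕ (suc n)
      f : ℕ → ℚ[i]
      f j = (x + fromℕ j) ^ n
      x+[1+k]≡1+[x+k] : x + fromℕ (suc k) ≡ 1# + (x + fromℕ k)
      x+[1+k]≡1+[x+k] = trans (cong (x +_) (fromℕ-homo-+ 1 k))
        (solve 2 (λ x k → x :+ (con 1# :+ k) := con 1# :+ (x :+ k)) refl x (fromℕ k))

module BernoulliNumbers where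

  open IntegerEmbedding using ([1+n]*1/[1+n]≡1)
  open GaussianRationals
  open BinomialSums
  open AppellPolynomials
  open import Data.Nat as ℕ using (ℕ; zero; suc; _∸_)
  import Data.Nat.Properties as ℕ
  open import Data.Nat.Combinatorics using (_C_; nCk≡nC[n∸k]; nC1≡n; nCn≡1)
  open import Data.Integer using (+_)
  open import Data.Rational as ℚ using (ℚ)
  open import Data.List using (List; []; _∷_; _++_; [_]; _∷ʳ_; length; foldr; applyUpTo)
  open import Data.List.Properties using (applyUpTo-∷ʳ; length-applyUpTo)
  open import Data.Product using (∃₂; _,_)
  open import Relation.Binary.PropositionalEquality hiding ([_])

  private
    sumℚ : List ℚ → ℚ
    sumℚ = foldr (λ p acc → p ℚ.+ acc) ℚ.0ℚ

  -- The helpers of bernoulliNext and B are anonymous where-functions in Defs;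
  -- the two metas below are solved to them by unifying against their unfoldings.
  mutual
    summands : List ℚ → ℕ → List ℚ → List ℚ
    summands = _

    private
      summands-solved : ∀ x₀ x₁ r → bernoulliNext (x₀ ∷ x₁ ∷ r) ≡
        ℚ.- (((+ 1) ℚ./ suc (length (x₀ ∷ x₁ ∷ r))) ℚ.*
          (ℤ→ℚ (+ (suc (length (x₀ ∷ x₁ ∷ r)) C 0)) ℚ.* x₀ ℚ.+
          (ℤ→ℚ (+ (suc (length (x₀ ∷ x₁ ∷ r)) C 1)) ℚ.* x₁ ℚ.+
          sumℚ (summands (x₀ ∷ x₁ ∷ r) 2 r))))
      summands-solved x₀ x₁ r with x₀ ∷ x₁ ∷ r | 2 | sumℚ
      ... | w | k | F = refl

  mutual
    lastOf : ℕ → List ℚ → ℚ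
    lastOf = _

    B≡lastOf : ∀ m → B m ≡ lastOf m (bernoulliList (suc m))
    B≡lastOf m with bernoulliList (suc m)
    ... | L = refl

  lastOf-∷ʳ : ∀ m xs y → lastOf m (xs ++ [ y ]) ≡ y
  lastOf-∷ʳ m []            y = refl
  lastOf-∷ʳ m (x ∷ [])      y = refl
  lastOf-∷ʳ m (x ∷ x′ ∷ xs) y = lastOf-∷ʳ m (x′ ∷ xs) y

  bernoulliList-nonempty : ∀ k → ∃₂ λ x xs → bernoulliList (suc k) ≡ x ∷ xs
  bernoulliList-nonempty zero = _ , _ , refl
  bernoulliList-nonempty (suc k) with bernoulliList (suc k) | bernoulliList-nonempty k
  ... | x ∷ xs | _ = x , _ , refl

  bernoulliList-suc : ∀ k →
    bernoulliList (suc (suc k)) ≡ bernoulliList (suc k) ++ [ bernoulliNext (bernoulliList (suc k)) ]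
  bernoulliList-suc k with bernoulliList (suc k) | bernoulliList-nonempty k
  ... | x ∷ xs | _ = refl

  B-suc : ∀ k → B (suc k) ≡ bernoulliNext (bernoulliList (suc k))
  B-suc k = trans (B≡lastOf (suc k)) (trans (cong (lastOf (suc k)) (bernoulliList-suc k))
    (lastOf-∷ʳ (suc k) (bernoulliList (suc k)) (bernoulliNext (bernoulliList (suc k)))))

  bernoulliList≡applyUpTo : ∀ n → bernoulliList n ≡ applyUpTo B n
  bernoulliList≡applyUpTo zero          = refl
  bernoulliList≡applyUpTo (suc zero)    = refl
  bernoulliList≡applyUpTo (suc (suc k)) = begin
    bernoulliList (suc (suc k))
      ≡⟨ bernoulliList-suc k ⟩
    bernoulliList (suc k) ++ [ bernoulliNext (bernoulliList (suc k)) ]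
      ≡⟨ cong₂ (λ L y → L ++ [ y ]) (bernoulliList≡applyUpTo (suc k)) (sym (B-suc k)) ⟩
    applyUpTo B (suc k) ∷ʳ B (suc k)
      ≡⟨ applyUpTo-∷ʳ B (suc k) ⟩
    applyUpTo B (suc (suc k)) ∎
    where open ≡-Reasoning

  b : ℕ → ℚ[i]
  b k = fromℚ (B k)

  summands-applyUpTo : ∀ w k (g : ℕ → ℚ) n →
    fromℚ (sumℚ (summands w k (applyUpTo g n)))
      ≡ ∑ n (λ j → fromℕ (suc (length w) C (k ℕ.+ j)) * fromℚ (g j))
  summands-applyUpTo w k g zero    = refl
  summands-applyUpTo w k g (suc n) = begin
    fromℚ (ℤ→ℚ (+ (N C k)) ℚ.* g 0 ℚ.+ sumℚ (summands w (suc k) (applyUpTo (λ j → g (suc j)) n)))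
      ≡⟨ fromℚ-homo-+ (ℤ→ℚ (+ (N C k)) ℚ.* g 0) (sumℚ (summands w (suc k) (applyUpTo (λ j → g (suc j)) n))) ⟩
    fromℚ (ℤ→ℚ (+ (N C k)) ℚ.* g 0) + fromℚ (sumℚ (summands w (suc k) (applyUpTo (λ j → g (suc j)) n)))
      ≡⟨ cong₂ _+_ (trans (fromℚ-homo-* (ℤ→ℚ (+ (N C k))) (g 0)) (cong (λ i → fromℕ (N C i) * fromℚ (g 0)) (sym (ℕ.+-identityʳ k))))
                   (summands-applyUpTo w (suc k) (λ j → g (suc j)) n) ⟩
    fromℕ (N C (k ℕ.+ 0)) * fromℚ (g 0) + ∑ n (λ j → fromℕ (N C (suc k ℕ.+ j)) * fromℚ (g (suc j)))
      ≡⟨ cong (_+_ (fromℕ (N C (k ℕ.+ 0)) * fromℚ (g 0)))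
           (∑-cong n (λ j → cong (λ i → fromℕ (N C i) * fromℚ (g (suc j))) (sym (ℕ.+-suc k j)))) ⟩
    fromℕ (N C (k ℕ.+ 0)) * fromℚ (g 0) + ∑ n (λ j → fromℕ (N C (k ℕ.+ suc j)) * fromℚ (g (suc j))) ∎
    where
    open ≡-Reasoning
    N : ℕ
    N = suc (length w)

  b-suc : ∀ m → b (suc m) ≡ - (fromℚ ((+ 1) ℚ./ suc (suc m)) * ∑ (suc m) (λ k → fromℕ (suc (suc m) C k) * b k))
  b-suc m = begin
    fromℚ (B (suc m))
      ≡⟨ cong fromℚ (trans (B-suc m) (cong bernoulliNext (bernoulliList≡applyUpTo (suc m)))) ⟩
    fromℚ (bernoulliNext L)
      ≡⟨ cong (λ l → - fromℚ (((+ 1) ℚ./ suc l) ℚ.* sumℚ (summands L 0 L))) (length-applyUpTo B (suc m)) ⟩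
    - fromℚ (((+ 1) ℚ./ suc (suc m)) ℚ.* sumℚ (summands L 0 L))
      ≡⟨ cong -_ (fromℚ-homo-* ((+ 1) ℚ./ suc (suc m)) (sumℚ (summands L 0 L))) ⟩
    - (fromℚ ((+ 1) ℚ./ suc (suc m)) * fromℚ (sumℚ (summands L 0 L)))
      ≡⟨ cong (λ s → - (fromℚ ((+ 1) ℚ./ suc (suc m)) * s)) (summands-applyUpTo L 0 B (suc m)) ⟩
    - (fromℚ ((+ 1) ℚ./ suc (suc m)) * ∑ (suc m) (λ k → fromℕ (suc (length L) C k) * b k))
      ≡⟨ cong (λ l → - (fromℚ ((+ 1) ℚ./ suc (suc m)) * ∑ (suc m) (λ k → fromℕ (suc l C k) * b k))) (length-applyUpTo B (suc m)) ⟩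
    - (fromℚ ((+ 1) ℚ./ suc (suc m)) * ∑ (suc m) (λ k → fromℕ (suc (suc m) C k) * b k)) ∎
    where
    open ≡-Reasoning
    L : List ℚ
    L = applyUpTo B (suc m)

  bernoulli-sum≡0 : ∀ m → ∑ (suc (suc m)) (λ k → fromℕ (suc (suc m) C k) * b k) ≡ 0#
  bernoulli-sum≡0 m = begin
    ∑ (suc N) f
      ≡⟨ ∑-suc-last N f ⟩
    S + fromℕ (suc N C N) * b N
      ≡⟨ cong₂ (λ c t → S + fromℕ c * t) [1+n]C[n]≡1+n (b-suc m) ⟩
    S + fromℕ (suc N) * - (fromℚ c * S)
      ≡⟨ solve 3 (λ s a c → s :+ a :* :- (c :* s) := s :- (a :* c) :* s) refl S (fromℕ (suc N)) (fromℚ c) ⟩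
    S - fromℕ (suc N) * fromℚ c * S
      ≡⟨ cong (λ t → S - t * S) (trans (sym (fromℚ-homo-* (ℤ→ℚ (+ suc N)) c)) (cong fromℚ ([1+n]*1/[1+n]≡1 N))) ⟩
    S - 1# * S
      ≡⟨ solve 1 (λ s → s :- con 1# :* s := con 0#) refl S ⟩
    0# ∎
    where
    open ≡-Reasoning
    N : ℕ
    N = suc m
    c : ℚ
    c = (+ 1) ℚ./ suc N
    f : ℕ → ℚ[i]
    f k = fromℕ (suc N C k) * b k
    S : ℚ[i]
    S = ∑ N f
    [1+n]C[n]≡1+n : suc N C N ≡ suc N
    [1+n]C[n]≡1+n = trans (nCk≡nC[n∸k] (ℕ.n≤1+n N)) (trans (cong (suc N C_) (ℕ.m+n∸n≡m 1 N)) (nC1≡n (suc N)))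

  P-b-at-1 : ∀ j → P b j 1# ≡ b j + δ₁ j
  P-b-at-1 j = begin
    P b j 1#
      ≡⟨ P≡conv-coefficients b j 1# ⟩
    conv j b (1# ^_)
      ≡⟨ ∑-cong (suc j) (λ k → cong (fromℕ (j C k) *_) (trans (cong (b k *_) (1#^n≡1# (j ∸ k))) (*-identityʳ (b k)))) ⟩
    ∑ (suc j) (λ k → fromℕ (j C k) * b k)
      ≡⟨ bernoulli-recurrence j ⟩
    b j + δ₁ j ∎
    where
    open ≡-Reasoning
    bernoulli-recurrence : ∀ j → ∑ (suc j) (λ k → fromℕ (j C k) * b k) ≡ b j + δ₁ j
    bernoulli-recurrence zero = solve 1 (λ x → con 1# :* x :+ con 0# := x :+ con 0#) refl (b 0)
    -- here b 0 computes to 1#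
    bernoulli-recurrence (suc zero) = solve 1 (λ x → con 1# :* con 1# :+ (con 1# :* x :+ con 0#) := x :+ con 1#) refl (b 1)
    bernoulli-recurrence (suc (suc m)) = begin
      ∑ (suc (suc (suc m))) (λ k → fromℕ (suc (suc m) C k) * b k)
        ≡⟨ ∑-suc-last (suc (suc m)) (λ k → fromℕ (suc (suc m) C k) * b k) ⟩
      ∑ (suc (suc m)) (λ k → fromℕ (suc (suc m) C k) * b k) + fromℕ (suc (suc m) C suc (suc m)) * b (suc (suc m))
        ≡⟨ cong₂ (λ s c → s + fromℕ c * b (suc (suc m))) (bernoulli-sum≡0 m) (nCn≡1 (suc (suc m))) ⟩
      0# + fromℕ 1 * b (suc (suc m))
        ≡⟨ solve 1 (λ x → con 0# :+ con 1# :* x := x :+ con 0#) refl (b (suc (suc m))) ⟩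
      b (suc (suc m)) + 0# ∎

module GaussianEvaluation where

  open GaussianRationals
  open BinomialSums
  open AppellPolynomials
  open BernoulliNumbers using (b; P-b-at-1)
  open LucasSequences using (^-difference≡U)
  open import Data.Nat as ℕ using (ℕ; zero; suc; _∸_; z≤n; s≤s)
  import Data.Nat.Properties as ℕ
  open import Data.Nat.DivMod using (_/_; _%_; m%n<n; m≡m%n+[m/n]*n; m*n/n≡m; m/n≡1+[m∸n]/n; m*n/o*n≡m/o)
  open import Data.Nat.Tactic.RingSolver using (solve-∀)
  open import Data.Nat.Combinatorics using (_C_)
  open import Data.Integer as ℤ using (ℤ; +_; -[1+_])
  import Data.Integer.Properties as ℤ
  open import Data.Integer.Tactic.RingSolver using () renaming (solve-∀ to ℤ-solve-∀)
  open import Data.Rational as ℚ using (ℚ)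
  open import Data.List using (foldr; applyUpTo)
  open import Data.Bool using (if_then_else_)
  open import Relation.Binary.PropositionalEquality
  open ≡-Reasoning

  gauss : ℤ → ℤ → ℚ[i]
  gauss x y = ℤ→ℚ x +i ℤ→ℚ y

  -- αⱼ = iʲ (2 + 2i)
  α₀ α₁ α₂ α₃ : ℚ[i]
  α₀ = gauss (+ 2) (+ 2)
  α₁ = gauss -[1+ 1 ] (+ 2)
  α₂ = gauss -[1+ 1 ] -[1+ 1 ]
  α₃ = gauss (+ 2) -[1+ 1 ]

  2i 4i : ℚ[i]
  2i = gauss (+ 0) (+ 2)
  4i = gauss (+ 0) (+ 4)

  powDiff : ℚ[i] → ℚ[i] → ℕ → ℚ[i]
  powDiff x y k = x ^ k - y ^ k

  powDiff-+ : ∀ {x y c} j k → x ^ j ≡ c → y ^ j ≡ c → powDiff x y (j ℕ.+ k) ≡ c * powDiff x y k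
  powDiff-+ {x} {y} {c} j k xʲ≡c yʲ≡c = begin
    x ^ (j ℕ.+ k) - y ^ (j ℕ.+ k)    ≡⟨ cong₂ _-_ (^-homo-* x j k) (^-homo-* y j k) ⟩
    x ^ j * x ^ k - y ^ j * y ^ k    ≡⟨ cong₂ (λ s t → s * x ^ k - t * y ^ k) xʲ≡c yʲ≡c ⟩
    c * x ^ k - c * y ^ k            ≡⟨ solve 3 (λ c a b → c :* a :- c :* b := c :* (a :- b)) refl c (x ^ k) (y ^ k) ⟩
    c * (x ^ k - y ^ k)              ∎

  φ : ℕ → ℚ[i]
  φ k = powDiff α₀ α₁ k + powDiff α₂ α₃ k

  φ-periodic : ∀ q r → φ (q ℕ.* 4 ℕ.+ r) ≡ fromℤ (ℤ.- + 64) ^ q * φ r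
  φ-periodic zero    r = sym (*-identityˡ (φ r))
  φ-periodic (suc q) r = begin
    φ (4 ℕ.+ (q ℕ.* 4 ℕ.+ r))
      ≡⟨ cong₂ _+_ (powDiff-+ 4 (q ℕ.* 4 ℕ.+ r) refl refl) (powDiff-+ 4 (q ℕ.* 4 ℕ.+ r) refl refl) ⟩
    c * powDiff α₀ α₁ (q ℕ.* 4 ℕ.+ r) + c * powDiff α₂ α₃ (q ℕ.* 4 ℕ.+ r)
      ≡⟨ solve 3 (λ c a b → c :* a :+ c :* b := c :* (a :+ b)) refl c _ _ ⟩
    c * φ (q ℕ.* 4 ℕ.+ r)
      ≡⟨ cong (c *_) (φ-periodic q r) ⟩
    c * (c ^ q * φ r)
      ≡⟨ sym (*-assoc c (c ^ q) (φ r)) ⟩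
    c ^ suc q * φ r ∎
    where
    c : ℚ[i]
    c = fromℤ (ℤ.- + 64)

  φ-vanishes : ∀ q r → φ r ≡ 0# → φ (q ℕ.* 4 ℕ.+ r) ≡ 0#
  φ-vanishes q r φr≡0 = begin
    φ (q ℕ.* 4 ℕ.+ r)              ≡⟨ φ-periodic q r ⟩
    fromℤ (ℤ.- + 64) ^ q * φ r      ≡⟨ cong (fromℤ (ℤ.- + 64) ^ q *_) φr≡0 ⟩
    fromℤ (ℤ.- + 64) ^ q * 0#       ≡⟨ solve 1 (λ a → a :* con 0# := con 0#) refl (fromℤ (ℤ.- + 64) ^ q) ⟩
    0#                              ∎

  -- α₀⁴ = −64 = (−1)·2⁶ and φ 2 = 32 i = 4i·2³.
  φ-2-mod-4 : ∀ q → φ (q ℕ.* 4 ℕ.+ 2) ≡ 4i * fromℤ (sgn q ℤ.* (+ 2) ℤ.^ (6 ℕ.* q ℕ.+ 3))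
  φ-2-mod-4 q = begin
    φ (q ℕ.* 4 ℕ.+ 2)
      ≡⟨ φ-periodic q 2 ⟩
    (-one * two ^ 6) ^ q * (4i * two ^ 3)
      ≡⟨ cong (_* (4i * two ^ 3)) (trans (^-distrib-* -one (two ^ 6) q) (cong (-one ^ q *_) (^-assocʳ two 6 q))) ⟩
    -one ^ q * two ^ (6 ℕ.* q) * (4i * two ^ 3)
      ≡⟨ solve 4 (λ s a i b → s :* a :* (i :* b) := i :* (s :* (a :* b))) refl (-one ^ q) (two ^ (6 ℕ.* q)) 4i (two ^ 3) ⟩
    4i * (-one ^ q * (two ^ (6 ℕ.* q) * two ^ 3))
      ≡⟨ cong (λ t → 4i * (-one ^ q * t)) (sym (^-homo-* two (6 ℕ.* q) 3)) ⟩
    4i * (-one ^ q * two ^ (6 ℕ.* q ℕ.+ 3))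
      ≡⟨ cong (4i *_) (sym (trans (fromℤ-homo-* (sgn q) ((+ 2) ℤ.^ (6 ℕ.* q ℕ.+ 3)))
                                  (cong₂ _*_ (fromℤ-homo-^ ℤ.-1ℤ q) (fromℤ-homo-^ (+ 2) (6 ℕ.* q ℕ.+ 3))))) ⟩
    4i * fromℤ (sgn q ℤ.* (+ 2) ℤ.^ (6 ℕ.* q ℕ.+ 3)) ∎
    where
    -one two : ℚ[i]
    -one = fromℤ ℤ.-1ℤ
    two = fromℤ (+ 2)

  lhsTerm : ℕ → ℕ → ℚ
  lhsTerm n k = if (k % 4) ℕ.≡ᵇ 2
    then ℤ→ℚ (+ (n C k) ℤ.* sgn ((k ∸ 2) / 4) ℤ.* (+ 2) ℤ.^ ((3 ℕ.* k) / 2)) ℚ.* B (n ∸ k)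
    else ℚ.0ℚ

  private
    φ-term-vanishing : ∀ n k r → k ≡ k / 4 ℕ.* 4 ℕ.+ r → φ r ≡ 0# →
      fromℕ (n C k) * (φ k * b (n ∸ k)) ≡ 4i * 0#
    φ-term-vanishing n k r k≡ φr≡0 = begin
      fromℕ (n C k) * (φ k * b (n ∸ k))
        ≡⟨ cong (λ t → fromℕ (n C k) * (t * b (n ∸ k))) (trans (cong φ k≡) (φ-vanishes (k / 4) r φr≡0)) ⟩
      fromℕ (n C k) * (0# * b (n ∸ k))
        ≡⟨ solve 2 (λ c x → c :* (con 0# :* x) := con 4i :* con 0#) refl (fromℕ (n C k)) (b (n ∸ k)) ⟩
      4i * 0# ∎

    φ-term-2-mod-4 : ∀ n k → k ≡ k / 4 ℕ.* 4 ℕ.+ 2 →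
      fromℕ (n C k) * (φ k * b (n ∸ k))
        ≡ 4i * fromℚ (ℤ→ℚ (+ (n C k) ℤ.* sgn ((k ∸ 2) / 4) ℤ.* (+ 2) ℤ.^ ((3 ℕ.* k) / 2)) ℚ.* B (n ∸ k))
    φ-term-2-mod-4 n k k≡ = begin
      fromℕ (n C k) * (φ k * b (n ∸ k))
        ≡⟨ cong (λ t → fromℕ (n C k) * (t * b (n ∸ k))) (trans (cong φ k≡) (φ-2-mod-4 q)) ⟩
      fromℕ (n C k) * (4i * fromℤ (sgn q ℤ.* p) * b (n ∸ k))
        ≡⟨ solve 4 (λ c i z x → c :* (i :* z :* x) := i :* (c :* z :* x)) refl (fromℕ (n C k)) 4i (fromℤ (sgn q ℤ.* p)) (b (n ∸ k)) ⟩
      4i * (fromℕ (n C k) * fromℤ (sgn q ℤ.* p) * b (n ∸ k))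
        ≡⟨ cong (λ t → 4i * (t * b (n ∸ k))) (sym (fromℤ-homo-* (+ (n C k)) (sgn q ℤ.* p))) ⟩
      4i * (fromℤ (+ (n C k) ℤ.* (sgn q ℤ.* p)) * b (n ∸ k))
        ≡⟨ cong (λ z → 4i * (fromℤ z * b (n ∸ k))) (sym (ℤ.*-assoc (+ (n C k)) (sgn q) p)) ⟩
      4i * (fromℤ (+ (n C k) ℤ.* sgn q ℤ.* p) * b (n ∸ k))
        ≡⟨ cong₂ (λ s e → 4i * (fromℤ (+ (n C k) ℤ.* sgn s ℤ.* (+ 2) ℤ.^ e) * b (n ∸ k))) (sym [k∸2]/4≡q) (sym 3k/2≡6q+3) ⟩
      4i * (fromℤ z * b (n ∸ k))
        ≡⟨ cong (4i *_) (sym (fromℚ-homo-* (ℤ→ℚ z) (B (n ∸ k)))) ⟩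
      4i * fromℚ (ℤ→ℚ z ℚ.* B (n ∸ k)) ∎
      where
      q : ℕ
      q = k / 4
      p z : ℤ
      p = (+ 2) ℤ.^ (6 ℕ.* q ℕ.+ 3)
      z = + (n C k) ℤ.* sgn ((k ∸ 2) / 4) ℤ.* (+ 2) ℤ.^ ((3 ℕ.* k) / 2)
      [k∸2]/4≡q : (k ∸ 2) / 4 ≡ q
      [k∸2]/4≡q = trans (cong (λ t → (t ∸ 2) / 4) k≡) (trans (cong (_/ 4) (ℕ.m+n∸n≡m (q ℕ.* 4) 2)) (m*n/n≡m q 4))
      [3*[4q+2]]≡[6q+3]*2 : ∀ q → 3 ℕ.* (q ℕ.* 4 ℕ.+ 2) ≡ (6 ℕ.* q ℕ.+ 3) ℕ.* 2
      [3*[4q+2]]≡[6q+3]*2 = solve-∀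
      3k/2≡6q+3 : (3 ℕ.* k) / 2 ≡ 6 ℕ.* q ℕ.+ 3
      3k/2≡6q+3 = trans (cong (λ t → (3 ℕ.* t) / 2) k≡)
        (trans (cong (_/ 2) ([3*[4q+2]]≡[6q+3]*2 q)) (m*n/n≡m (6 ℕ.* q ℕ.+ 3) 2))

  φ-term : ∀ n k → fromℕ (n C k) * (φ k * b (n ∸ k)) ≡ 4i * fromℚ (lhsTerm n k)
  φ-term n k with k % 4 | m%n<n k 4 | trans (m≡m%n+[m/n]*n k 4) (ℕ.+-comm (k % 4) (k / 4 ℕ.* 4))
  ... | 0 | _ | k≡ = φ-term-vanishing n k 0 k≡ refl
  ... | 1 | _ | k≡ = φ-term-vanishing n k 1 k≡ refl
  ... | 2 | _ | k≡ = φ-term-2-mod-4 n k k≡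
  ... | 3 | _ | k≡ = φ-term-vanishing n k 3 k≡ refl
  ... | suc (suc (suc (suc _))) | s≤s (s≤s (s≤s (s≤s ()))) | _

  fromℚ-foldr : ∀ (f : ℕ → ℚ) (g : ℕ → ℕ) m →
    fromℚ (foldr (λ k acc → f k ℚ.+ acc) ℚ.0ℚ (applyUpTo g m)) ≡ ∑ m (λ k → fromℚ (f (g k)))
  fromℚ-foldr f g zero    = refl
  fromℚ-foldr f g (suc m) = trans (fromℚ-homo-+ (f (g 0)) (foldr (λ k acc → f k ℚ.+ acc) ℚ.0ℚ (applyUpTo (λ k → g (suc k)) m))) (cong (_+_ (fromℚ (f (g 0)))) (fromℚ-foldr f (λ k → g (suc k)) m))

  W : ℕ → ℚ[i]
  W n = (P b n α₀ - P b n α₁) + (P b n α₂ - P b n α₃)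

  W≡4i*lhs : ∀ n → W n ≡ 4i * fromℚ (lhs n)
  W≡4i*lhs n = begin
    (P b n α₀ - P b n α₁) + (P b n α₂ - P b n α₃)
      ≡⟨ cong₂ _+_ (cong₂ _-_ (P≡conv-powers b n α₀) (P≡conv-powers b n α₁))
                   (cong₂ _-_ (P≡conv-powers b n α₂) (P≡conv-powers b n α₃)) ⟩
    (conv n (α₀ ^_) b - conv n (α₁ ^_) b) + (conv n (α₂ ^_) b - conv n (α₃ ^_) b)
      ≡⟨ sym (cong₂ _+_ (conv-minus-left n (α₀ ^_) (α₁ ^_) b) (conv-minus-left n (α₂ ^_) (α₃ ^_) b)) ⟩
    conv n (powDiff α₀ α₁) b + conv n (powDiff α₂ α₃) b
      ≡⟨ sym (conv-+-left n (powDiff α₀ α₁) (powDiff α₂ α₃) b) ⟩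
    conv n φ b
      ≡⟨ ∑-cong (suc n) (φ-term n) ⟩
    ∑ (suc n) (λ k → 4i * fromℚ (lhsTerm n k))
      ≡⟨ sym (*-∑ (suc n) 4i (λ k → fromℚ (lhsTerm n k))) ⟩
    4i * ∑ (suc n) (λ k → fromℚ (lhsTerm n k))
      ≡⟨ cong (4i *_) (sym (fromℚ-foldr (lhsTerm n) (λ k → k) (suc n))) ⟩
    4i * fromℚ (lhs n) ∎

  W-telescoped : ∀ E → W (suc E) ≡ fromℕ (suc E) * ∑ 4 (λ j → powDiff (α₁ + fromℕ j) (α₂ + fromℕ j) E)
  W-telescoped E = begin
    (P b (suc E) α₀ - P₁) + (P₂ - P b (suc E) α₃)
      ≡⟨ cong₂ (λ s t → (s - P₁) + (P₂ - t)) (P-shift b P-b-at-1 E α₁ 4) (P-shift b P-b-at-1 E α₂ 4) ⟩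
    (P₁ + c * S₁ - P₁) + (P₂ - (P₂ + c * S₂))
      ≡⟨ solve 5 (λ p₁ p₂ c s₁ s₂ → (p₁ :+ c :* s₁ :- p₁) :+ (p₂ :- (p₂ :+ c :* s₂)) := c :* (s₁ :- s₂)) refl P₁ P₂ c S₁ S₂ ⟩
    c * (S₁ - S₂)
      ≡⟨ cong (c *_) (sym (∑-distrib-minus 4 (λ j → (α₁ + fromℕ j) ^ E) (λ j → (α₂ + fromℕ j) ^ E))) ⟩
    c * ∑ 4 (λ j → powDiff (α₁ + fromℕ j) (α₂ + fromℕ j) E) ∎
    where
    P₁ P₂ c S₁ S₂ : ℚ[i]
    P₁ = P b (suc E) α₁
    P₂ = P b (suc E) α₂
    c  = fromℕ (suc E)
    S₁ = ∑ 4 (λ j → (α₁ + fromℕ j) ^ E)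
    S₂ = ∑ 4 (λ j → (α₂ + fromℕ j) ^ E)

  pair₀ : ∀ m → powDiff α₁ α₂ (suc (m ℕ.* 2)) ≡ 2i * fromℤ (sgn (m / 2) ℤ.* (+ 2) ℤ.^ suc (m ℕ.* 3))
  pair₀ zero          = refl
  pair₀ (suc zero)    = refl
  pair₀ (suc (suc m)) = begin
    powDiff α₁ α₂ (4 ℕ.+ suc (m ℕ.* 2))
      ≡⟨ powDiff-+ 4 (suc (m ℕ.* 2)) refl refl ⟩
    fromℤ (ℤ.- + 64) * powDiff α₁ α₂ (suc (m ℕ.* 2))
      ≡⟨ cong (fromℤ (ℤ.- + 64) *_) (pair₀ m) ⟩
    fromℤ (ℤ.- + 64) * (2i * fromℤ (s ℤ.* p))
      ≡⟨ solve 2 (λ c x → c :* (con 2i :* x) := con 2i :* (c :* x)) refl (fromℤ (ℤ.- + 64)) (fromℤ (s ℤ.* p)) ⟩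
    2i * (fromℤ (ℤ.- + 64) * fromℤ (s ℤ.* p))
      ≡⟨ cong (2i *_) (sym (fromℤ-homo-* (ℤ.- + 64) (s ℤ.* p))) ⟩
    2i * fromℤ (ℤ.- + 64 ℤ.* (s ℤ.* p))
      ≡⟨ cong (λ z → 2i * fromℤ z) (-64sp≡-s2⁶p s p) ⟩
    2i * fromℤ (sgn (suc (m / 2)) ℤ.* (+ 2) ℤ.^ suc (suc (suc m) ℕ.* 3))
      ≡⟨ cong (λ e → 2i * fromℤ (sgn e ℤ.* (+ 2) ℤ.^ suc (suc (suc m) ℕ.* 3))) (sym (m/n≡1+[m∸n]/n {suc (suc m)} {2} (s≤s (s≤s z≤n)))) ⟩
    2i * fromℤ (sgn (suc (suc m) / 2) ℤ.* (+ 2) ℤ.^ suc (suc (suc m) ℕ.* 3)) ∎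
    where
    s p : ℤ
    s = sgn (m / 2)
    p = (+ 2) ℤ.^ suc (m ℕ.* 3)
    -64sp≡-s2⁶p : ∀ s p → ℤ.- + 64 ℤ.* (s ℤ.* p)
      ≡ (ℤ.-1ℤ ℤ.* s) ℤ.* ((+ 2) ℤ.* ((+ 2) ℤ.* ((+ 2) ℤ.* ((+ 2) ℤ.* ((+ 2) ℤ.* ((+ 2) ℤ.* p))))))
    -64sp≡-s2⁶p = ℤ-solve-∀

  -2i : ℚ[i]
  -2i = gauss (+ 0) -[1+ 1 ]

  pair₂ : ∀ m → powDiff 2i -2i (suc (m ℕ.* 2)) ≡ 2i * fromℤ (ℤ.- (sgn (suc m) ℤ.* (+ 2) ℤ.^ suc (m ℕ.* 2)))
  pair₂ zero    = refl
  pair₂ (suc m) = begin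
    powDiff 2i -2i (2 ℕ.+ suc (m ℕ.* 2))
      ≡⟨ powDiff-+ 2 (suc (m ℕ.* 2)) refl refl ⟩
    fromℤ (ℤ.- + 4) * powDiff 2i -2i (suc (m ℕ.* 2))
      ≡⟨ cong (fromℤ (ℤ.- + 4) *_) (pair₂ m) ⟩
    fromℤ (ℤ.- + 4) * (2i * fromℤ (ℤ.- (s ℤ.* p)))
      ≡⟨ solve 2 (λ c x → c :* (con 2i :* x) := con 2i :* (c :* x)) refl (fromℤ (ℤ.- + 4)) (fromℤ (ℤ.- (s ℤ.* p))) ⟩
    2i * (fromℤ (ℤ.- + 4) * fromℤ (ℤ.- (s ℤ.* p)))
      ≡⟨ cong (2i *_) (sym (fromℤ-homo-* (ℤ.- + 4) (ℤ.- (s ℤ.* p)))) ⟩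
    2i * fromℤ (ℤ.- + 4 ℤ.* ℤ.- (s ℤ.* p))
      ≡⟨ cong (λ z → 2i * fromℤ z) (-4[-sp]≡-[-s2²p] s p) ⟩
    2i * fromℤ (ℤ.- (sgn (suc (suc m)) ℤ.* (+ 2) ℤ.^ suc (suc m ℕ.* 2))) ∎
    where
    s p : ℤ
    s = sgn (suc m)
    p = (+ 2) ℤ.^ suc (m ℕ.* 2)
    -4[-sp]≡-[-s2²p] : ∀ s p → ℤ.- + 4 ℤ.* ℤ.- (s ℤ.* p) ≡ ℤ.- ((ℤ.-1ℤ ℤ.* s) ℤ.* ((+ 2) ℤ.* ((+ 2) ℤ.* p)))
    -4[-sp]≡-[-s2²p] = ℤ-solve-∀

  -- 1 ± 2i are the roots of X² − 2X + 5, and −1 ± 2i = −(1 ∓ 2i).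
  pairs₁₃ : ∀ m → powDiff (α₁ + fromℕ 1) (α₂ + fromℕ 1) (suc (m ℕ.* 2)) + powDiff (α₁ + fromℕ 3) (α₂ + fromℕ 3) (suc (m ℕ.* 2))
    ≡ 2i * fromℤ ((+ 4) ℤ.* U (suc (m ℕ.* 2)) (+ 2) (+ 5))
  pairs₁₃ m = begin
    powDiff (- β̄) (- β) E + powDiff β β̄ E
      ≡⟨ cong₂ (λ s t → s - t + powDiff β β̄ E) (-‿^-odd β̄ m) (-‿^-odd β m) ⟩
    - β̄ ^ E - - β ^ E + powDiff β β̄ E
      ≡⟨ solve 2 (λ a b → :- b :- :- a :+ (a :- b) := con (fromℕ 2) :* (a :- b)) refl (β ^ E) (β̄ ^ E) ⟩
    fromℕ 2 * powDiff β β̄ E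
      ≡⟨ cong (fromℕ 2 *_) (^-difference≡U (+ 2) (+ 5) refl refl E) ⟩
    fromℕ 2 * ((β - β̄) * fromℤ (U E (+ 2) (+ 5)))
      ≡⟨ solve 1 (λ u → con (fromℕ 2) :* (con (β - β̄) :* u) := con 2i :* (con (fromℤ (+ 4)) :* u)) refl (fromℤ (U E (+ 2) (+ 5))) ⟩
    2i * (fromℤ (+ 4) * fromℤ (U E (+ 2) (+ 5)))
      ≡⟨ cong (2i *_) (sym (fromℤ-homo-* (+ 4) (U E (+ 2) (+ 5)))) ⟩
    2i * fromℤ ((+ 4) ℤ.* U E (+ 2) (+ 5)) ∎
    where
    E : ℕ
    E = suc (m ℕ.* 2)
    β β̄ : ℚ[i]
    β = α₁ + fromℕ 3
    β̄ = α₂ + fromℕ 3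

  X : ℕ → ℤ
  X m = sgn (m / 2) ℤ.* (+ 2) ℤ.^ suc (m ℕ.* 3)
    ℤ.- sgn (suc m) ℤ.* (+ 2) ℤ.^ suc (m ℕ.* 2)
    ℤ.+ (+ 4) ℤ.* U (suc (m ℕ.* 2)) (+ 2) (+ 5)

  conjugate-pairs : ∀ m → ∑ 4 (λ j → powDiff (α₁ + fromℕ j) (α₂ + fromℕ j) (suc (m ℕ.* 2))) ≡ 2i * fromℤ (X m)
  conjugate-pairs m = begin
    d 0 + (d 1 + (d 2 + (d 3 + 0#)))
      ≡⟨ solve 4 (λ a b c e → a :+ (b :+ (c :+ (e :+ con 0#))) := a :+ c :+ (b :+ e)) refl (d 0) (d 1) (d 2) (d 3) ⟩
    d 0 + d 2 + (d 1 + d 3)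
      ≡⟨ cong₂ _+_ (cong₂ _+_ (pair₀ m) (pair₂ m)) (pairs₁₃ m) ⟩
    2i * fromℤ x₀ + 2i * fromℤ x₂ + 2i * fromℤ x₁₃
      ≡⟨ solve 3 (λ a b c → con 2i :* a :+ con 2i :* b :+ con 2i :* c := con 2i :* (a :+ b :+ c)) refl
           (fromℤ x₀) (fromℤ x₂) (fromℤ x₁₃) ⟩
    2i * (fromℤ x₀ + fromℤ x₂ + fromℤ x₁₃)
      ≡⟨ cong (2i *_) (sym (trans (fromℤ-homo-+ (x₀ ℤ.+ x₂) x₁₃) (cong (_+ fromℤ x₁₃) (fromℤ-homo-+ x₀ x₂)))) ⟩
    2i * fromℤ (x₀ ℤ.+ x₂ ℤ.+ x₁₃) ∎
    where
    d : ℕ → ℚ[i]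
    d j = powDiff (α₁ + fromℕ j) (α₂ + fromℕ j) (suc (m ℕ.* 2))
    x₀ x₂ x₁₃ : ℤ
    x₀  = sgn (m / 2) ℤ.* (+ 2) ℤ.^ suc (m ℕ.* 3)
    x₂  = ℤ.- (sgn (suc m) ℤ.* (+ 2) ℤ.^ suc (m ℕ.* 2))
    x₁₃ = (+ 4) ℤ.* U (suc (m ℕ.* 2)) (+ 2) (+ 5)

  private
    m+[1+m]≡1+2m : ∀ m → m ℕ.+ suc (m ℕ.+ 0) ≡ suc (m ℕ.* 2)
    m+[1+m]≡1+2m = solve-∀

    [2+2m]∸1≡1+2m : ∀ m → 2 ℕ.* suc m ∸ 1 ≡ suc (m ℕ.* 2)
    [2+2m]∸1≡1+2m = m+[1+m]≡1+2m

    [2+2m]≡2+2m : ∀ m → 2 ℕ.* suc m ≡ 2 ℕ.+ m ℕ.* 2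
    [2+2m]≡2+2m = solve-∀

    3[2+2m]≡[3+3m]2 : ∀ m → 3 ℕ.* (2 ℕ.* suc m) ≡ (3 ℕ.+ m ℕ.* 3) ℕ.* 2
    3[2+2m]≡[3+3m]2 = solve-∀

  rhs≡[1+m]X : ∀ m → rhs (2 ℕ.* suc m) ≡ + suc m ℤ.* X m
  rhs≡[1+m]X m = rhs-shape n/2≡1+m [n∸2]/4≡m/2 [3n/2]∸2≡1+3m ([2+2m]∸1≡1+2m m)
    where
    n : ℕ
    n = 2 ℕ.* suc m
    rhs-shape : ∀ {h h′ a a′ c c′ e e′ : ℕ} → h ≡ h′ → a ≡ a′ → c ≡ c′ → e ≡ e′ →
      + h ℤ.* (sgn a ℤ.* (+ 2) ℤ.^ c ℤ.- sgn h ℤ.* (+ 2) ℤ.^ e ℤ.+ (+ 4) ℤ.* U e (+ 2) (+ 5))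
        ≡ + h′ ℤ.* (sgn a′ ℤ.* (+ 2) ℤ.^ c′ ℤ.- sgn h′ ℤ.* (+ 2) ℤ.^ e′ ℤ.+ (+ 4) ℤ.* U e′ (+ 2) (+ 5))
    rhs-shape refl refl refl refl = refl
    n/2≡1+m : n / 2 ≡ suc m
    n/2≡1+m = trans (cong (_/ 2) (ℕ.*-comm 2 (suc m))) (m*n/n≡m (suc m) 2)
    [n∸2]/4≡m/2 : (n ∸ 2) / 4 ≡ m / 2
    [n∸2]/4≡m/2 = trans (cong (λ t → (t ∸ 2) / 4) ([2+2m]≡2+2m m)) (m*n/o*n≡m/o m 2 2)
    [3n/2]∸2≡1+3m : (3 ℕ.* n) / 2 ∸ 2 ≡ suc (m ℕ.* 3)
    [3n/2]∸2≡1+3m = cong (_∸ 2) (trans (cong (_/ 2) (3[2+2m]≡[3+3m]2 m)) (m*n/n≡m (3 ℕ.+ m ℕ.* 3) 2))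

  W≡4i*rhs : ∀ m → W (2 ℕ.* suc m) ≡ 4i * fromℤ (rhs (2 ℕ.* suc m))
  W≡4i*rhs m = begin
    W (suc (n ∸ 1))
      ≡⟨ W-telescoped (n ∸ 1) ⟩
    fromℕ n * ∑ 4 (d (n ∸ 1))
      ≡⟨ cong (λ e → fromℕ n * ∑ 4 (d e)) ([2+2m]∸1≡1+2m m) ⟩
    fromℕ n * ∑ 4 (d (suc (m ℕ.* 2)))
      ≡⟨ cong (fromℕ n *_) (conjugate-pairs m) ⟩
    fromℕ n * (2i * fromℤ (X m))
      ≡⟨ cong (_* (2i * fromℤ (X m))) (fromℕ-homo-* 2 (suc m)) ⟩
    fromℕ 2 * fromℕ (suc m) * (2i * fromℤ (X m))
      ≡⟨ solve 2 (λ a x → con (fromℕ 2) :* a :* (con 2i :* x) := con 4i :* (a :* x)) refl (fromℕ (suc m)) (fromℤ (X m)) ⟩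
    4i * (fromℕ (suc m) * fromℤ (X m))
      ≡⟨ cong (4i *_) (sym (fromℤ-homo-* (+ suc m) (X m))) ⟩
    4i * fromℤ (+ suc m ℤ.* X m)
      ≡⟨ cong (λ z → 4i * fromℤ z) (sym (rhs≡[1+m]X m)) ⟩
    4i * fromℤ (rhs n) ∎
    where
    n : ℕ
    n = 2 ℕ.* suc m
    d : ℕ → ℕ → ℚ[i]
    d e j = powDiff (α₁ + fromℕ j) (α₂ + fromℕ j) e

  4i*-injective : ∀ x y → 4i * x ≡ 4i * y → x ≡ y
  4i*-injective x y = *-cancelˡ {c⁻¹ = ℚ.0ℚ +i (ℚ.- ((+ 1) ℚ./ 4))} x y refl

open import Data.Nat using (ℕ; suc; _*_)
open import Relation.Binary.PropositionalEquality using (_≡_; cong; sym; trans)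
open GaussianRationals using (re; fromℚ; fromℤ)
open GaussianEvaluation using (W≡4i*lhs; W≡4i*rhs; 4i*-injective)

corollary2p6 : (m : ℕ) → let n = 2 * suc m in lhs n ≡ ℤ→ℚ (rhs n)
corollary2p6 m = cong re (4i*-injective (fromℚ (lhs n)) (fromℤ (rhs n)) (trans (sym (W≡4i*lhs n)) (W≡4i*rhs m)))
  where
  n : ℕ
  n = 2 * suc m
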